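{- Let $\mathcal R$ be a rewrite system and let $\Gamma_1$ and $\Gamma_2$ be two finite axiomatic presentations both compatible with $\mathcal R$. Then there is a constant $C$ such that for every proposition $P$ and every $n$, if $\Gamma_1\vdash^{n}P$ then $\Gamma_2\vdash^{Cn}P$; that is, a proof of length $n$ using assumptions from $\Gamma_1$ can be translated into a proof of length $O(n)$ using assumptions from $\Gamma_2$ (both in pure natural deduction).
   Context: Propositions are first-order (possibly many-sorted) propositions built from atomic propositions, $\bot$, $\top$, $\wedge$, $\vee$, $\Rightarrow$, $\forall$, $\exists$; $P\Leftrightarrow Q$ abbreviates $(P\Rightarrow Q)\wedge(Q\Rightarrow P)$. A rewrite system $\mathcal R$ is a set of term rewrite rules $l\to r$ (terms, free variables of $r$ among those of $l$) and proposition rewrite rules $A\to P$ ($A$ atomic, free variables of $P$ among those of $A$); one-step rewriting replaces an instance $\sigma l$ (resp. $\sigma A$) occurring in a term or proposition by $\sigma r$ (resp. $\sigma P$), and $\leftrightarrow^*_{\mathcal R}$ is the congruence it generates. Natural deduction modulo $\mathcal R$ has the rules of classical natural deduction (introduction/elimination for $\Rightarrow,\wedge,\vee,\forall,\exists$, $\top$-introduction, $\bot$-elimination, and the premise-free rule concluding $B\vee(B\Rightarrow\bot)$), each applicable when the involved propositions have the required shapes up to $\leftrightarrow^*_{\mathcal R}$. The length of a proof is its number of inference steps. $\Gamma\vdash^k_{\mathcal R}P$ means there is a proof of $P$ of length at most $k$ modulo $\mathcal R$ with undischarged assumptions in a finite subset of $\Gamma$; $\Gamma\vdash_{\mathcal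 R}P$ means this for some $k$; without subscript, $\mathcal R=\emptyset$ (pure natural deduction). $\Gamma$ is compatible with $\mathcal R$ if (i) $P\leftrightarrow^*_{\mathcal R}Q$ implies $\Gamma\vdash P\Leftrightarrow Q$ and (ii) $\vdash_{\mathcal R}P$ for all $P\in\Gamma$. -}

module Defs where

open import Data.Nat using (ℕ; zero; suc; _+_; _≤_)
open import Data.List using (List; []; _∷_; map)
open import Data.List.Membership.Propositional using (_∈_)
open import Data.Product using (Σ; _×_; _,_)
open import Data.Empty using (⊥)
open import Relation.Binary.PropositionalEquality using (_≡_)
open import Relation.Binary.Construct.Closure.Equivalence using (EqClosure)

record Signature : Set₁ where
  field
    Sort     : Set
    FunSym   : Set
    funArgs  : FunSym → List Sort
    funRes   : FunSym → Sort
    PredSym  : Set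
    predArgs : PredSym → List Sort

open Signature public

module _ {S : Signature} where

  data Var : List (Sort S) → Sort S → Set where
    here  : ∀ {Δ s} → Var (s ∷ Δ) s
    there : ∀ {Δ s s'} → Var Δ s → Var (s' ∷ Δ) s

  mutual
    data Term (Δ : List (Sort S)) : Sort S → Set where
      var : ∀ {s} → Var Δ s → Term Δ s
      app : (f : FunSym S) → Terms Δ (funArgs S f) → Term Δ (funRes S f)

    data Terms (Δ : List (Sort S)) : List (Sort S) → Set where
      []  : Terms Δ []
      _∷_ : ∀ {s ss} → Term Δ s → Terms Δ ss → Terms Δ (s ∷ ss)

  infixr 6 _∧'_
  infixr 5 _∨'_
  infixr 4 _⇒'_

  data Form (Δ : List (Sort S)) : Set where
    atom : (p : PredSym S) → Terms Δ (predArgs S p) → Form Δ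
    ⊥' ⊤' : Form Δ
    _∧'_ _∨'_ _⇒'_ : Form Δ → Form Δ → Form Δ
    ∀' ∃' : (s : Sort S) → Form (s ∷ Δ) → Form Δ

  _⇔'_ : ∀ {Δ} → Form Δ → Form Δ → Form Δ
  P ⇔' Q = (P ⇒' Q) ∧' (Q ⇒' P)

  Ren : List (Sort S) → List (Sort S) → Set
  Ren Δ Δ' = ∀ {s} → Var Δ s → Var Δ' s

  liftR : ∀ {Δ Δ' s} → Ren Δ Δ' → Ren (s ∷ Δ) (s ∷ Δ')
  liftR ρ here      = here
  liftR ρ (there x) = there (ρ x)

  mutual
    renT : ∀ {Δ Δ' s} → Ren Δ Δ' → Term Δ s → Term Δ' s
    renT ρ (var x)    = var (ρ x)
    renT ρ (app f ts) = app f (renTs ρ ts)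

    renTs : ∀ {Δ Δ' ss} → Ren Δ Δ' → Terms Δ ss → Terms Δ' ss
    renTs ρ []       = []
    renTs ρ (t ∷ ts) = renT ρ t ∷ renTs ρ ts

  renF : ∀ {Δ Δ'} → Ren Δ Δ' → Form Δ → Form Δ'
  renF ρ (atom p ts) = atom p (renTs ρ ts)
  renF ρ ⊥'          = ⊥'
  renF ρ ⊤'          = ⊤'
  renF ρ (A ∧' B)    = renF ρ A ∧' renF ρ B
  renF ρ (A ∨' B)    = renF ρ A ∨' renF ρ B
  renF ρ (A ⇒' B)    = renF ρ A ⇒' renF ρ B
  renF ρ (∀' s A)    = ∀' s (renF (liftR ρ) A)
  renF ρ (∃' s A)    = ∃' s (renF (liftR ρ) A)

  Sub : List (Sort S) → List (Sort S) → Set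
  Sub Δ Δ' = ∀ {s} → Var Δ s → Term Δ' s

  liftS : ∀ {Δ Δ' s} → Sub Δ Δ' → Sub (s ∷ Δ) (s ∷ Δ')
  liftS σ here      = var here
  liftS σ (there x) = renT there (σ x)

  mutual
    subT : ∀ {Δ Δ' s} → Sub Δ Δ' → Term Δ s → Term Δ' s
    subT σ (var x)    = σ x
    subT σ (app f ts) = app f (subTs σ ts)

    subTs : ∀ {Δ Δ' ss} → Sub Δ Δ' → Terms Δ ss → Terms Δ' ss
    subTs σ []       = []
    subTs σ (t ∷ ts) = subT σ t ∷ subTs σ ts

  subF : ∀ {Δ Δ'} → Sub Δ Δ' → Form Δ → Form Δ'
  subF σ (atom p ts) = atom p (subTs σ ts)
  subF σ ⊥'          = ⊥'
  subF σ ⊤'          = ⊤'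
  subF σ (A ∧' B)    = subF σ A ∧' subF σ B
  subF σ (A ∨' B)    = subF σ A ∨' subF σ B
  subF σ (A ⇒' B)    = subF σ A ⇒' subF σ B
  subF σ (∀' s A)    = ∀' s (subF (liftS σ) A)
  subF σ (∃' s A)    = ∃' s (subF (liftS σ) A)

  single : ∀ {Δ s} → Term Δ s → Sub (s ∷ Δ) Δ
  single t here      = t
  single t (there x) = var x

  _[_] : ∀ {Δ s} → Form (s ∷ Δ) → Term Δ s → Form Δ
  A [ t ] = subF (single t) A

  wkF : ∀ {Δ s} → Form Δ → Form (s ∷ Δ)
  wkF = renF there

  noVar : ∀ {Δ} → Ren [] Δ
  noVar ()

  closedIn : ∀ Δ → Form [] → Form Δ
  closedIn Δ = renF (noVar {Δ})

  mutual
    data OccT {Δ s} (x : Var Δ s) : ∀ {s'} → Term Δ s' → Set where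
      var : OccT x (var x)
      app : ∀ {f ts} → OccTs x ts → OccT x (app f ts)

    data OccTs {Δ s} (x : Var Δ s) : ∀ {ss} → Terms Δ ss → Set where
      head : ∀ {s' ss} {t : Term Δ s'} {ts : Terms Δ ss} → OccT x t → OccTs x (t ∷ ts)
      tail : ∀ {s' ss} {t : Term Δ s'} {ts : Terms Δ ss} → OccTs x ts → OccTs x (t ∷ ts)

  data OccF {Δ s} (x : Var Δ s) : Form Δ → Set where
    atom : ∀ {p ts} → OccTs x ts → OccF x (atom p ts)
    ∧l : ∀ {A B} → OccF x A → OccF x (A ∧' B)
    ∧r : ∀ {A B} → OccF x B → OccF x (A ∧' B)
    ∨l : ∀ {A B} → OccF x A → OccF x (A ∨' B)
    ∨r : ∀ {A B} → OccF x B → OccF x (A ∨' B)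
    ⇒l : ∀ {A B} → OccF x A → OccF x (A ⇒' B)
    ⇒r : ∀ {A B} → OccF x B → OccF x (A ⇒' B)
    ∀' : ∀ {s' A} → OccF (there x) A → OccF x (∀' s' A)
    ∃' : ∀ {s' A} → OccF (there x) A → OccF x (∃' s' A)

  record TermRule : Set where
    field
      ctx  : List (Sort S)
      sort : Sort S
      lhs  : Term ctx sort
      rhs  : Term ctx sort
      fv   : ∀ {s} (x : Var ctx s) → OccT x rhs → OccT x lhs

  record PropRule : Set where
    field
      ctx  : List (Sort S)
      pred : PredSym S
      args : Terms ctx (predArgs S pred)
      rhs  : Form ctx
      fv   : ∀ {s} (x : Var ctx s) → OccF x rhs → OccF x (atom pred args)

  record RewriteSystem : Set₁ where
    field
      termRules : TermRule → Set
      propRules : PropRule → Set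

  emptyRS : RewriteSystem
  emptyRS = record { termRules = λ _ → ⊥ ; propRules = λ _ → ⊥ }

  module _ (R : RewriteSystem) where
    open RewriteSystem R

    mutual
      data StepT {Δ} : ∀ {s} → Term Δ s → Term Δ s → Set where
        root : (ρ : TermRule) → termRules ρ → (σ : Sub (TermRule.ctx ρ) Δ) →
               StepT (subT σ (TermRule.lhs ρ)) (subT σ (TermRule.rhs ρ))
        app  : ∀ {f ts ts'} → StepTs ts ts' → StepT (app f ts) (app f ts')

      data StepTs {Δ} : ∀ {ss} → Terms Δ ss → Terms Δ ss → Set where
        head : ∀ {s ss} {t t' : Term Δ s} {ts : Terms Δ ss} →
               StepT t t' → StepTs (t ∷ ts) (t' ∷ ts)
        tail : ∀ {s ss} {t : Term Δ s} {ts ts' : Terms Δ ss} →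
               StepTs ts ts' → StepTs (t ∷ ts) (t ∷ ts')

    data StepF {Δ} : Form Δ → Form Δ → Set where
      root : (ρ : PropRule) → propRules ρ → (σ : Sub (PropRule.ctx ρ) Δ) →
             StepF (atom (PropRule.pred ρ) (subTs σ (PropRule.args ρ)))
                   (subF σ (PropRule.rhs ρ))
      atom : ∀ {p ts ts'} → StepTs ts ts' → StepF (atom p ts) (atom p ts')
      ∧l : ∀ {A A' B} → StepF A A' → StepF (A ∧' B) (A' ∧' B)
      ∧r : ∀ {A B B'} → StepF B B' → StepF (A ∧' B) (A ∧' B')
      ∨l : ∀ {A A' B} → StepF A A' → StepF (A ∨' B) (A' ∨' B)
      ∨r : ∀ {A B B'} → StepF B B' → StepF (A ∨' B) (A ∨' B')
      ⇒l : ∀ {A A' B} → StepF A A' → StepF (A ⇒' B) (A' ⇒' B)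
      ⇒r : ∀ {A B B'} → StepF B B' → StepF (A ⇒' B) (A ⇒' B')
      ∀' : ∀ {s A A'} → StepF A A' → StepF (∀' s A) (∀' s A')
      ∃' : ∀ {s A A'} → StepF A A' → StepF (∃' s A) (∃' s A')

    _↔*_ : ∀ {Δ} → Form Δ → Form Δ → Set
    _↔*_ {Δ} = EqClosure (StepF {Δ})

    -- Classical natural deduction modulo R (sequent-style; H is the
    -- list of available assumptions, Δ the term-variable context)

    data Deriv {Δ} (H : List (Form Δ)) : Form Δ → Set where
      ax    : ∀ {A C} → A ∈ H → A ↔* C → Deriv H C
      ⇒I    : ∀ {A B C} → Deriv (A ∷ H) B → C ↔* (A ⇒' B) → Deriv H C
      ⇒E    : ∀ {A B D} → Deriv H D → D ↔* (A ⇒' B) → Deriv H A → Deriv H B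
      ∧I    : ∀ {A B C} → Deriv H A → Deriv H B → C ↔* (A ∧' B) → Deriv H C
      ∧E₁   : ∀ {A B D} → Deriv H D → D ↔* (A ∧' B) → Deriv H A
      ∧E₂   : ∀ {A B D} → Deriv H D → D ↔* (A ∧' B) → Deriv H B
      ∨I₁   : ∀ {A B C} → Deriv H A → C ↔* (A ∨' B) → Deriv H C
      ∨I₂   : ∀ {A B C} → Deriv H B → C ↔* (A ∨' B) → Deriv H C
      ∨E    : ∀ {A B C D} → Deriv H D → D ↔* (A ∨' B) →
              Deriv (A ∷ H) C → Deriv (B ∷ H) C → Deriv H C
      ∀I    : ∀ {s A C} → Deriv {s ∷ Δ} (map wkF H) A → C ↔* (∀' s A) →
              Deriv H C
      ∀E    : ∀ {s A D} → Deriv H D → D ↔* (∀' s A) → (t : Term Δ s) →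
              Deriv H (A [ t ])
      ∃I    : ∀ {s A C} (t : Term Δ s) → Deriv H (A [ t ]) →
              C ↔* (∃' s A) → Deriv H C
      ∃E    : ∀ {s A C D} → Deriv H D → D ↔* (∃' s A) →
              Deriv {s ∷ Δ} (A ∷ map wkF H) (wkF C) → Deriv H C
      ⊤I    : ∀ {C} → C ↔* ⊤' → Deriv H C
      ⊥E    : ∀ {D C} → Deriv H D → D ↔* ⊥' → Deriv H C
      EM    : ∀ {B C} → C ↔* (B ∨' (B ⇒' ⊥')) → Deriv H C

    size : ∀ {Δ} {H : List (Form Δ)} {C} → Deriv H C → ℕ
    size (ax _ _)         = 1
    size (⇒I d _)         = suc (size d)
    size (⇒E d _ e)       = suc (size d + size e)
    size (∧I d e _)       = suc (size d + size e)
    size (∧E₁ d _)        = suc (size d)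
    size (∧E₂ d _)        = suc (size d)
    size (∨I₁ d _)        = suc (size d)
    size (∨I₂ d _)        = suc (size d)
    size (∨E d _ e f)     = suc (size d + size e + size f)
    size (∀I d _)         = suc (size d)
    size (∀E d _ _)       = suc (size d)
    size (∃I _ d _)       = suc (size d)
    size (∃E d _ e)       = suc (size d + size e)
    size (⊤I _)           = 1
    size (⊥E d _)         = suc (size d)
    size (EM _)           = 1

    _⊢[_]_ : ∀ {Δ} → List (Form []) → ℕ → Form Δ → Set
    _⊢[_]_ {Δ} Γ k P = Σ (Deriv (map (closedIn Δ) Γ) P) λ d → size d ≤ k

  _⊢^_∶_ : ∀ {Δ} → List (Form []) → ℕ → Form Δ → Set
  Γ ⊢^ k ∶ P = _⊢[_]_ emptyRS Γ k P

  Compatible : RewriteSystem → List (Form []) → Set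
  Compatible R Γ =
    (∀ {Δ} (P Q : Form Δ) → _↔*_ R P Q → Σ ℕ λ k → Γ ⊢^ k ∶ (P ⇔' Q))
    × (∀ (P : Form []) → P ∈ Γ → Σ ℕ λ k → _⊢[_]_ R [] k P)

module Submission where

-- The proof replaces every use of an axiom of Γ₁ by a fixed pure proof of
-- that axiom from Γ₂.  Such proofs exist: an axiom B ∈ Γ₁ is provable modulo
-- R without assumptions (compatibility (ii) of Γ₁), and any proof modulo R
-- becomes a pure proof once every conversion P ↔* Q is replaced by the proof
-- of P ⇔ Q from Γ₂ (compatibility (i) of Γ₂).  Since Γ₁ is finite, these
-- axiom proofs have lengths bounded by some K, and substituting proofs of
-- length ≤ K for hypotheses multiplies the length of a proof by at most K.

open import Defs
open import Data.Nat using (ℕ; _*_; suc; _+_; _≤_; z≤n; s≤s; _⊔_)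
open import Data.Nat.Properties using (≤-trans; ≤-reflexive; +-mono-≤; *-distribˡ-+; *-identityʳ; *-suc; *-monoʳ-≤; m≤m⊔n; m≤n⊔m; n≤1+n)
open import Data.List using (List; []; _∷_; map)
open import Data.List.Properties using (map-∘; map-cong)
open import Data.List.Membership.Propositional using (_∈_)
open import Data.List.Membership.Propositional.Properties using (∈-map⁺; ∈-map⁻)
open import Data.List.Relation.Binary.Subset.Propositional using (_⊆_)
open import Data.List.Relation.Binary.Subset.Propositional.Properties using (map⁺; ∷⁺ʳ; xs⊆x∷xs)
import Data.List.Relation.Unary.Any as Any
open import Data.Product using (∃-syntax; Σ; _,_; proj₁; proj₂)
open import Data.Empty using (⊥; ⊥-elim)
open import Relation.Binary.PropositionalEquality using (_≡_; refl; sym; trans; cong; cong₂; subst)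
open import Relation.Binary.Construct.Closure.ReflexiveTransitive using (ε; _◅_)
open import Relation.Binary.Construct.Closure.Symmetric using (fwd; bwd)
import Relation.Binary.Construct.Closure.Equivalence as EqClosure

module _ {S : Signature} where

  mutual
    renT-cong : ∀ {Δ Δ' s} {ρ ρ' : Ren {S} Δ Δ'} → (∀ {s'} (x : Var Δ s') → ρ x ≡ ρ' x) →
                (t : Term Δ s) → renT ρ t ≡ renT ρ' t
    renT-cong e (var x)    = cong var (e x)
    renT-cong e (app f ts) = cong (app f) (renTs-cong e ts)

    renTs-cong : ∀ {Δ Δ' ss} {ρ ρ' : Ren {S} Δ Δ'} → (∀ {s'} (x : Var Δ s') → ρ x ≡ ρ' x) →
                 (ts : Terms Δ ss) → renTs ρ ts ≡ renTs ρ' ts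
    renTs-cong e []       = refl
    renTs-cong e (t ∷ ts) = cong₂ _∷_ (renT-cong e t) (renTs-cong e ts)

  liftR-cong : ∀ {Δ Δ' s} {ρ ρ' : Ren {S} Δ Δ'} → (∀ {s'} (x : Var Δ s') → ρ x ≡ ρ' x) →
               ∀ {s'} (x : Var (s ∷ Δ) s') → liftR ρ x ≡ liftR ρ' x
  liftR-cong e here      = refl
  liftR-cong e (there x) = cong there (e x)

  renF-cong : ∀ {Δ Δ'} {ρ ρ' : Ren {S} Δ Δ'} → (∀ {s'} (x : Var Δ s') → ρ x ≡ ρ' x) →
              (A : Form Δ) → renF ρ A ≡ renF ρ' A
  renF-cong e (atom p ts) = cong (atom p) (renTs-cong e ts)
  renF-cong e ⊥'          = refl
  renF-cong e ⊤'          = refl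
  renF-cong e (A ∧' B)    = cong₂ _∧'_ (renF-cong e A) (renF-cong e B)
  renF-cong e (A ∨' B)    = cong₂ _∨'_ (renF-cong e A) (renF-cong e B)
  renF-cong e (A ⇒' B)    = cong₂ _⇒'_ (renF-cong e A) (renF-cong e B)
  renF-cong e (∀' s A)    = cong (∀' s) (renF-cong (liftR-cong e) A)
  renF-cong e (∃' s A)    = cong (∃' s) (renF-cong (liftR-cong e) A)

  mutual
    subT-cong : ∀ {Δ Δ' s} {σ σ' : Sub {S} Δ Δ'} → (∀ {s'} (x : Var Δ s') → σ x ≡ σ' x) →
                (t : Term Δ s) → subT σ t ≡ subT σ' t
    subT-cong e (var x)    = e x
    subT-cong e (app f ts) = cong (app f) (subTs-cong e ts)

    subTs-cong : ∀ {Δ Δ' ss} {σ σ' : Sub {S} Δ Δ'} → (∀ {s'} (x : Var Δ s') → σ x ≡ σ' x) →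
                 (ts : Terms Δ ss) → subTs σ ts ≡ subTs σ' ts
    subTs-cong e []       = refl
    subTs-cong e (t ∷ ts) = cong₂ _∷_ (subT-cong e t) (subTs-cong e ts)

  liftS-cong : ∀ {Δ Δ' s} {σ σ' : Sub {S} Δ Δ'} → (∀ {s'} (x : Var Δ s') → σ x ≡ σ' x) →
               ∀ {s'} (x : Var (s ∷ Δ) s') → liftS σ x ≡ liftS σ' x
  liftS-cong e here      = refl
  liftS-cong e (there x) = cong (renT there) (e x)

  subF-cong : ∀ {Δ Δ'} {σ σ' : Sub {S} Δ Δ'} → (∀ {s'} (x : Var Δ s') → σ x ≡ σ' x) →
              (A : Form Δ) → subF σ A ≡ subF σ' A
  subF-cong e (atom p ts) = cong (atom p) (subTs-cong e ts)
  subF-cong e ⊥'          = refl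
  subF-cong e ⊤'          = refl
  subF-cong e (A ∧' B)    = cong₂ _∧'_ (subF-cong e A) (subF-cong e B)
  subF-cong e (A ∨' B)    = cong₂ _∨'_ (subF-cong e A) (subF-cong e B)
  subF-cong e (A ⇒' B)    = cong₂ _⇒'_ (subF-cong e A) (subF-cong e B)
  subF-cong e (∀' s A)    = cong (∀' s) (subF-cong (liftS-cong e) A)
  subF-cong e (∃' s A)    = cong (∃' s) (subF-cong (liftS-cong e) A)

  mutual
    renT-∘ : ∀ {Δ Δ' Δ'' s} (ρ : Ren {S} Δ' Δ'') (ρ' : Ren Δ Δ') (t : Term Δ s) →
             renT ρ (renT ρ' t) ≡ renT (λ x → ρ (ρ' x)) t
    renT-∘ ρ ρ' (var x)    = refl
    renT-∘ ρ ρ' (app f ts) = cong (app f) (renTs-∘ ρ ρ' ts)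

    renTs-∘ : ∀ {Δ Δ' Δ'' ss} (ρ : Ren {S} Δ' Δ'') (ρ' : Ren Δ Δ') (ts : Terms Δ ss) →
              renTs ρ (renTs ρ' ts) ≡ renTs (λ x → ρ (ρ' x)) ts
    renTs-∘ ρ ρ' []       = refl
    renTs-∘ ρ ρ' (t ∷ ts) = cong₂ _∷_ (renT-∘ ρ ρ' t) (renTs-∘ ρ ρ' ts)

  renF-∘ : ∀ {Δ Δ' Δ''} (ρ : Ren {S} Δ' Δ'') (ρ' : Ren Δ Δ') (A : Form Δ) →
           renF ρ (renF ρ' A) ≡ renF (λ x → ρ (ρ' x)) A
  renF-∘ ρ ρ' (atom p ts) = cong (atom p) (renTs-∘ ρ ρ' ts)
  renF-∘ ρ ρ' ⊥'          = refl
  renF-∘ ρ ρ' ⊤'          = refl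
  renF-∘ ρ ρ' (A ∧' B)    = cong₂ _∧'_ (renF-∘ ρ ρ' A) (renF-∘ ρ ρ' B)
  renF-∘ ρ ρ' (A ∨' B)    = cong₂ _∨'_ (renF-∘ ρ ρ' A) (renF-∘ ρ ρ' B)
  renF-∘ ρ ρ' (A ⇒' B)    = cong₂ _⇒'_ (renF-∘ ρ ρ' A) (renF-∘ ρ ρ' B)
  renF-∘ ρ ρ' (∀' s A)    = cong (∀' s) (trans (renF-∘ (liftR ρ) (liftR ρ') A)
                              (renF-cong (λ { here → refl ; (there x) → refl }) A))
  renF-∘ ρ ρ' (∃' s A)    = cong (∃' s) (trans (renF-∘ (liftR ρ) (liftR ρ') A)
                              (renF-cong (λ { here → refl ; (there x) → refl }) A))

  mutual
    renT-subT : ∀ {Δ Δ' Δ'' s} (ρ : Ren {S} Δ' Δ'') (σ : Sub Δ Δ') (t : Term Δ s) →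
                renT ρ (subT σ t) ≡ subT (λ x → renT ρ (σ x)) t
    renT-subT ρ σ (var x)    = refl
    renT-subT ρ σ (app f ts) = cong (app f) (renTs-subTs ρ σ ts)

    renTs-subTs : ∀ {Δ Δ' Δ'' ss} (ρ : Ren {S} Δ' Δ'') (σ : Sub Δ Δ') (ts : Terms Δ ss) →
                  renTs ρ (subTs σ ts) ≡ subTs (λ x → renT ρ (σ x)) ts
    renTs-subTs ρ σ []       = refl
    renTs-subTs ρ σ (t ∷ ts) = cong₂ _∷_ (renT-subT ρ σ t) (renTs-subTs ρ σ ts)

  renT-liftS : ∀ {Δ Δ' Δ'' s} (ρ : Ren {S} Δ' Δ'') (σ : Sub Δ Δ') →
               ∀ {s'} (x : Var (s ∷ Δ) s') → renT (liftR ρ) (liftS σ x) ≡ liftS (λ y → renT ρ (σ y)) x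
  renT-liftS ρ σ here      = refl
  renT-liftS ρ σ (there x) = trans (renT-∘ (liftR ρ) there (σ x)) (sym (renT-∘ there ρ (σ x)))

  renF-subF : ∀ {Δ Δ' Δ''} (ρ : Ren {S} Δ' Δ'') (σ : Sub Δ Δ') (A : Form Δ) →
              renF ρ (subF σ A) ≡ subF (λ x → renT ρ (σ x)) A
  renF-subF ρ σ (atom p ts) = cong (atom p) (renTs-subTs ρ σ ts)
  renF-subF ρ σ ⊥'          = refl
  renF-subF ρ σ ⊤'          = refl
  renF-subF ρ σ (A ∧' B)    = cong₂ _∧'_ (renF-subF ρ σ A) (renF-subF ρ σ B)
  renF-subF ρ σ (A ∨' B)    = cong₂ _∨'_ (renF-subF ρ σ A) (renF-subF ρ σ B)
  renF-subF ρ σ (A ⇒' B)    = cong₂ _⇒'_ (renF-subF ρ σ A) (renF-subF ρ σ B)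
  renF-subF ρ σ (∀' s A)    = cong (∀' s) (trans (renF-subF (liftR ρ) (liftS σ) A)
                                (subF-cong (renT-liftS ρ σ) A))
  renF-subF ρ σ (∃' s A)    = cong (∃' s) (trans (renF-subF (liftR ρ) (liftS σ) A)
                                (subF-cong (renT-liftS ρ σ) A))

  mutual
    subT-renT : ∀ {Δ Δ' Δ'' s} (σ : Sub {S} Δ' Δ'') (ρ : Ren Δ Δ') (t : Term Δ s) →
                subT σ (renT ρ t) ≡ subT (λ x → σ (ρ x)) t
    subT-renT σ ρ (var x)    = refl
    subT-renT σ ρ (app f ts) = cong (app f) (subTs-renTs σ ρ ts)

    subTs-renTs : ∀ {Δ Δ' Δ'' ss} (σ : Sub {S} Δ' Δ'') (ρ : Ren Δ Δ') (ts : Terms Δ ss) →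
                  subTs σ (renTs ρ ts) ≡ subTs (λ x → σ (ρ x)) ts
    subTs-renTs σ ρ []       = refl
    subTs-renTs σ ρ (t ∷ ts) = cong₂ _∷_ (subT-renT σ ρ t) (subTs-renTs σ ρ ts)

  subF-renF : ∀ {Δ Δ' Δ''} (σ : Sub {S} Δ' Δ'') (ρ : Ren Δ Δ') (A : Form Δ) →
              subF σ (renF ρ A) ≡ subF (λ x → σ (ρ x)) A
  subF-renF σ ρ (atom p ts) = cong (atom p) (subTs-renTs σ ρ ts)
  subF-renF σ ρ ⊥'          = refl
  subF-renF σ ρ ⊤'          = refl
  subF-renF σ ρ (A ∧' B)    = cong₂ _∧'_ (subF-renF σ ρ A) (subF-renF σ ρ B)
  subF-renF σ ρ (A ∨' B)    = cong₂ _∨'_ (subF-renF σ ρ A) (subF-renF σ ρ B)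
  subF-renF σ ρ (A ⇒' B)    = cong₂ _⇒'_ (subF-renF σ ρ A) (subF-renF σ ρ B)
  subF-renF σ ρ (∀' s A)    = cong (∀' s) (trans (subF-renF (liftS σ) (liftR ρ) A)
                                (subF-cong (λ { here → refl ; (there x) → refl }) A))
  subF-renF σ ρ (∃' s A)    = cong (∃' s) (trans (subF-renF (liftS σ) (liftR ρ) A)
                                (subF-cong (λ { here → refl ; (there x) → refl }) A))

  renF-wkF : ∀ {Δ Δ' s} (ρ : Ren {S} Δ Δ') (A : Form Δ) →
             renF (liftR {s = s} ρ) (wkF A) ≡ wkF (renF ρ A)
  renF-wkF ρ A = trans (renF-∘ (liftR ρ) there A) (sym (renF-∘ there ρ A))

  renF-inst : ∀ {Δ Δ' s} (ρ : Ren {S} Δ Δ') (A : Form (s ∷ Δ)) (t : Term Δ s) →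
              renF ρ (A [ t ]) ≡ (renF (liftR ρ) A) [ renT ρ t ]
  renF-inst ρ A t = trans (renF-subF ρ (single t) A)
                   (trans (subF-cong (λ { here → refl ; (there x) → refl }) A)
                          (sym (subF-renF (single (renT ρ t)) (liftR ρ) A)))

  renF-closed : ∀ {Δ Δ'} (ρ : Ren {S} Δ Δ') (B : Form []) → renF ρ (closedIn Δ B) ≡ closedIn Δ' B
  renF-closed ρ B = trans (renF-∘ ρ noVar B) (renF-cong (λ ()) B)

  axioms : List (Form {S} []) → ∀ Δ → List (Form Δ)
  axioms Γ Δ = map (closedIn Δ) Γ

  renF-axioms : ∀ {Δ Δ'} (ρ : Ren {S} Δ Δ') (Γ : List (Form [])) →
                map (renF ρ) (axioms Γ Δ) ≡ axioms Γ Δ'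
  renF-axioms ρ Γ = trans (sym (map-∘ Γ)) (map-cong (renF-closed ρ) Γ)

  renF-wkHyps : ∀ {Δ Δ' s} (ρ : Ren {S} Δ Δ') (H : List (Form Δ)) →
                map (renF (liftR {s = s} ρ)) (map wkF H) ≡ map wkF (map (renF ρ) H)
  renF-wkHyps ρ H = trans (sym (map-∘ H)) (trans (map-cong (renF-wkF ρ) H) (map-∘ H))

  weaken : ∀ {R : RewriteSystem {S}} {Δ} {H H' : List (Form Δ)} {C} →
           Deriv R H C → H ⊆ H' → Deriv R H' C
  weaken (ax m c)       s = ax (s m) c
  weaken (⇒I d c)       s = ⇒I (weaken d (∷⁺ʳ _ s)) c
  weaken (⇒E d c e)     s = ⇒E (weaken d s) c (weaken e s)
  weaken (∧I d e c)     s = ∧I (weaken d s) (weaken e s) c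
  weaken (∧E₁ d c)      s = ∧E₁ (weaken d s) c
  weaken (∧E₂ d c)      s = ∧E₂ (weaken d s) c
  weaken (∨I₁ d c)      s = ∨I₁ (weaken d s) c
  weaken (∨I₂ d c)      s = ∨I₂ (weaken d s) c
  weaken (∨E d c e f)   s = ∨E (weaken d s) c (weaken e (∷⁺ʳ _ s)) (weaken f (∷⁺ʳ _ s))
  weaken (∀I d c)       s = ∀I (weaken d (map⁺ wkF s)) c
  weaken (∀E d c t)     s = ∀E (weaken d s) c t
  weaken (∃I t d c)     s = ∃I t (weaken d s) c
  weaken (∃E d c e)     s = ∃E (weaken d s) c (weaken e (∷⁺ʳ _ (map⁺ wkF s)))
  weaken (⊤I c)         s = ⊤I c
  weaken (⊥E d c)       s = ⊥E (weaken d s) c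
  weaken (EM c)         s = EM c

  size-weaken : ∀ {R : RewriteSystem {S}} {Δ} {H H' : List (Form Δ)} {C}
                (d : Deriv R H C) (s : H ⊆ H') → size R (weaken d s) ≡ size R d
  size-weaken (ax m c)     s = refl
  size-weaken (⇒I d c)     s = cong suc (size-weaken d _)
  size-weaken (⇒E d c e)   s = cong suc (cong₂ _+_ (size-weaken d s) (size-weaken e s))
  size-weaken (∧I d e c)   s = cong suc (cong₂ _+_ (size-weaken d s) (size-weaken e s))
  size-weaken (∧E₁ d c)    s = cong suc (size-weaken d s)
  size-weaken (∧E₂ d c)    s = cong suc (size-weaken d s)
  size-weaken (∨I₁ d c)    s = cong suc (size-weaken d s)
  size-weaken (∨I₂ d c)    s = cong suc (size-weaken d s)
  size-weaken (∨E d c e f) s =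
    cong suc (cong₂ _+_ (cong₂ _+_ (size-weaken d s) (size-weaken e _)) (size-weaken f _))
  size-weaken (∀I d c)     s = cong suc (size-weaken d _)
  size-weaken (∀E d c t)   s = cong suc (size-weaken d s)
  size-weaken (∃I t d c)   s = cong suc (size-weaken d s)
  size-weaken (∃E d c e)   s = cong suc (cong₂ _+_ (size-weaken d s) (size-weaken e _))
  size-weaken (⊤I c)       s = refl
  size-weaken (⊥E d c)     s = cong suc (size-weaken d s)
  size-weaken (EM c)       s = refl

  -- In pure natural deduction conversions are syntactic identities, since
  -- the empty rewrite system has no rewrite step.

  ∅ : RewriteSystem {S}
  ∅ = emptyRS

  mutual
    noStepT : ∀ {Δ s} {t t' : Term {S} Δ s} → StepT ∅ t t' → ⊥
    noStepT (root ρ () σ)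
    noStepT (app st) = noStepTs st

    noStepTs : ∀ {Δ ss} {t t' : Terms {S} Δ ss} → StepTs ∅ t t' → ⊥
    noStepTs (head st) = noStepT st
    noStepTs (tail st) = noStepTs st

  noStepF : ∀ {Δ} {A B : Form {S} Δ} → StepF ∅ A B → ⊥
  noStepF (root ρ () σ)
  noStepF (atom st) = noStepTs st
  noStepF (∧l st)   = noStepF st
  noStepF (∧r st)   = noStepF st
  noStepF (∨l st)   = noStepF st
  noStepF (∨r st)   = noStepF st
  noStepF (⇒l st)   = noStepF st
  noStepF (⇒r st)   = noStepF st
  noStepF (∀' st)   = noStepF st
  noStepF (∃' st)   = noStepF st

  pure-conv : ∀ {Δ} {A B : Form {S} Δ} → _↔*_ ∅ A B → A ≡ B
  pure-conv ε            = refl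
  pure-conv (fwd st ◅ _) = ⊥-elim (noStepF st)
  pure-conv (bwd st ◅ _) = ⊥-elim (noStepF st)

  renF-conv : ∀ {Δ Δ'} (ρ : Ren {S} Δ Δ') {A B : Form Δ} → _↔*_ ∅ A B → _↔*_ ∅ (renF ρ A) (renF ρ B)
  renF-conv ρ c with pure-conv c
  ... | refl = ε

  size-subst : ∀ {R : RewriteSystem {S}} {Δ} {H : List (Form Δ)} {C C'} (e : C ≡ C') (d : Deriv R H C) →
               size R (subst (Deriv R H) e d) ≡ size R d
  size-subst refl d = refl

  liftHyps : ∀ {Δ Δ' s} {ρ : Ren {S} Δ Δ'} {H : List (Form Δ)} {H' : List (Form Δ')} →
             map (renF ρ) H ⊆ H' → map (renF (liftR {s = s} ρ)) (map wkF H) ⊆ map wkF H'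
  liftHyps {ρ = ρ} {H} {H'} s = subst (_⊆ map wkF H') (sym (renF-wkHyps ρ H)) (map⁺ wkF s)

  rename : ∀ {Δ Δ'} (ρ : Ren {S} Δ Δ') {H : List (Form Δ)} {H' : List (Form Δ')} {C}
           (d : Deriv ∅ H C) → map (renF ρ) H ⊆ H' →
           Σ (Deriv ∅ H' (renF ρ C)) λ d' → size ∅ d' ≡ size ∅ d
  rename ρ (ax m c) s = ax (s (∈-map⁺ (renF ρ) m)) (renF-conv ρ c) , refl
  rename ρ (⇒I d c) s with rename ρ d (∷⁺ʳ _ s)
  ... | d' , e = ⇒I d' (renF-conv ρ c) , cong suc e
  rename ρ (⇒E d c f) s with rename ρ d s | rename ρ f s
  ... | d' , e | f' , e' = ⇒E d' (renF-conv ρ c) f' , cong suc (cong₂ _+_ e e')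
  rename ρ (∧I d f c) s with rename ρ d s | rename ρ f s
  ... | d' , e | f' , e' = ∧I d' f' (renF-conv ρ c) , cong suc (cong₂ _+_ e e')
  rename ρ (∧E₁ d c) s with rename ρ d s
  ... | d' , e = ∧E₁ d' (renF-conv ρ c) , cong suc e
  rename ρ (∧E₂ d c) s with rename ρ d s
  ... | d' , e = ∧E₂ d' (renF-conv ρ c) , cong suc e
  rename ρ (∨I₁ d c) s with rename ρ d s
  ... | d' , e = ∨I₁ d' (renF-conv ρ c) , cong suc e
  rename ρ (∨I₂ d c) s with rename ρ d s
  ... | d' , e = ∨I₂ d' (renF-conv ρ c) , cong suc e
  rename ρ (∨E d c f g) s with rename ρ d s | rename ρ f (∷⁺ʳ _ s) | rename ρ g (∷⁺ʳ _ s)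
  ... | d' , e | f' , e' | g' , e'' = ∨E d' (renF-conv ρ c) f' g' , cong suc (cong₂ _+_ (cong₂ _+_ e e') e'')
  rename ρ (∀I d c) s with rename (liftR ρ) d (liftHyps s)
  ... | d' , e = ∀I d' (renF-conv ρ c) , cong suc e
  rename ρ (∀E {A = A} d c t) s with rename ρ d s
  ... | d' , e = subst (Deriv ∅ _) (sym (renF-inst ρ A t)) (∀E d' (renF-conv ρ c) (renT ρ t)) ,
                 trans (size-subst (sym (renF-inst ρ A t)) _) (cong suc e)
  rename ρ (∃I {A = A} t d c) s with rename ρ d s
  ... | d' , e = ∃I (renT ρ t) (subst (Deriv ∅ _) (renF-inst ρ A t) d') (renF-conv ρ c) ,
                 cong suc (trans (size-subst (renF-inst ρ A t) d') e)
  rename ρ (∃E {C = C} d c f) s with rename ρ d s | rename (liftR ρ) f (∷⁺ʳ _ (liftHyps s))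
  ... | d' , e | f' , e' = ∃E d' (renF-conv ρ c) (subst (Deriv ∅ _) (renF-wkF ρ C) f') ,
                           cong suc (cong₂ _+_ e (trans (size-subst (renF-wkF ρ C) f') e'))
  rename ρ (⊤I c) s = ⊤I (renF-conv ρ c) , refl
  rename ρ (⊥E d c) s with rename ρ d s
  ... | d' , e = ⊥E d' (renF-conv ρ c) , cong suc e
  rename ρ (EM c) s = EM (renF-conv ρ c) , refl


  _⊩[_]_ : ∀ {Δ} → List (Form {S} Δ) → ℕ → List (Form Δ) → Set
  H' ⊩[ K ] H = ∀ {A} → A ∈ H → Σ (Deriv ∅ H' A) λ d → size ∅ d ≤ K

  ⊩-∷ : ∀ {Δ K} {A : Form {S} Δ} {H H'} → 1 ≤ K → H' ⊩[ K ] H → (A ∷ H') ⊩[ K ] (A ∷ H)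
  ⊩-∷ 1≤K proofs (Any.here refl) = ax (Any.here refl) ε , 1≤K
  ⊩-∷ {H' = H'} 1≤K proofs (Any.there m) with proofs m
  ... | d , |d|≤K = weaken d (xs⊆x∷xs H' _) ,
                    ≤-trans (≤-reflexive (size-weaken d (xs⊆x∷xs H' _))) |d|≤K

  ⊩-rename : ∀ {Δ Δ' K} (ρ : Ren {S} Δ Δ') {H H' : List (Form Δ)} →
             H' ⊩[ K ] H → map (renF ρ) H' ⊩[ K ] map (renF ρ) H
  ⊩-rename ρ proofs m with ∈-map⁻ (renF ρ) m
  ... | A , m' , refl with proofs m'
  ... | d , |d|≤K with rename ρ d (λ n → n)
  ... | d' , |d'|≡|d| = d' , ≤-trans (≤-reflexive |d'|≡|d|) |d|≤K

  -- Length arithmetic for substitution: a rule with premises of lengths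
  -- a, b, … becomes a rule with premises of lengths ≤ K a, K b, …, and a
  -- leaf becomes a proof of length ≤ K.

  +-linear : ∀ K {a b a' b'} → a' ≤ K * a → b' ≤ K * b → a' + b' ≤ K * (a + b)
  +-linear K {a} {b} a'≤ b'≤ = ≤-trans (+-mono-≤ a'≤ b'≤) (≤-reflexive (sym (*-distribˡ-+ K a b)))

  unit-linear : ∀ {K a} → a ≤ K → a ≤ K * 1
  unit-linear {K} a≤K = ≤-trans a≤K (≤-reflexive (sym (*-identityʳ K)))

  suc-linear : ∀ {K a a'} → 1 ≤ K → a' ≤ K * a → suc a' ≤ K * suc a
  suc-linear {K} {a} {a'} 1≤K a'≤ = subst (suc a' ≤_) (sym (*-suc K a)) (+-mono-≤ 1≤K a'≤)

  substHyps : ∀ {Δ K} {H H' : List (Form {S} Δ)} {C} → 1 ≤ K → H' ⊩[ K ] H →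
              (d : Deriv ∅ H C) → Σ (Deriv ∅ H' C) λ d' → size ∅ d' ≤ K * size ∅ d
  substHyps 1≤K proofs (ax m c) with proofs m | pure-conv c
  ... | d , |d|≤K | refl = d , unit-linear |d|≤K
  substHyps 1≤K proofs (⇒I d c) with substHyps 1≤K (⊩-∷ 1≤K proofs) d
  ... | d' , b = ⇒I d' c , suc-linear 1≤K b
  substHyps {K = K} 1≤K proofs (⇒E d c e) with substHyps 1≤K proofs d | substHyps 1≤K proofs e
  ... | d' , b | e' , b' = ⇒E d' c e' , suc-linear 1≤K (+-linear K b b')
  substHyps {K = K} 1≤K proofs (∧I d e c) with substHyps 1≤K proofs d | substHyps 1≤K proofs e
  ... | d' , b | e' , b' = ∧I d' e' c , suc-linear 1≤K (+-linear K b b')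
  substHyps 1≤K proofs (∧E₁ d c) with substHyps 1≤K proofs d
  ... | d' , b = ∧E₁ d' c , suc-linear 1≤K b
  substHyps 1≤K proofs (∧E₂ d c) with substHyps 1≤K proofs d
  ... | d' , b = ∧E₂ d' c , suc-linear 1≤K b
  substHyps 1≤K proofs (∨I₁ d c) with substHyps 1≤K proofs d
  ... | d' , b = ∨I₁ d' c , suc-linear 1≤K b
  substHyps 1≤K proofs (∨I₂ d c) with substHyps 1≤K proofs d
  ... | d' , b = ∨I₂ d' c , suc-linear 1≤K b
  substHyps {K = K} 1≤K proofs (∨E d c e f)
    with substHyps 1≤K proofs d | substHyps 1≤K (⊩-∷ 1≤K proofs) e | substHyps 1≤K (⊩-∷ 1≤K proofs) f
  ... | d' , b | e' , b' | f' , b'' = ∨E d' c e' f' , suc-linear 1≤K (+-linear K (+-linear K b b') b'')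
  substHyps 1≤K proofs (∀I d c) with substHyps 1≤K (⊩-rename there proofs) d
  ... | d' , b = ∀I d' c , suc-linear 1≤K b
  substHyps 1≤K proofs (∀E d c t) with substHyps 1≤K proofs d
  ... | d' , b = ∀E d' c t , suc-linear 1≤K b
  substHyps 1≤K proofs (∃I t d c) with substHyps 1≤K proofs d
  ... | d' , b = ∃I t d' c , suc-linear 1≤K b
  substHyps {K = K} 1≤K proofs (∃E d c e)
    with substHyps 1≤K proofs d | substHyps 1≤K (⊩-∷ 1≤K (⊩-rename there proofs)) e
  ... | d' , b | e' , b' = ∃E d' c e' , suc-linear 1≤K (+-linear K b b')
  substHyps 1≤K proofs (⊤I c) = ⊤I c , unit-linear 1≤K
  substHyps 1≤K proofs (⊥E d c) with substHyps 1≤K proofs d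
  ... | d' , b = ⊥E d' c , suc-linear 1≤K b
  substHyps 1≤K proofs (EM c) = EM c , unit-linear 1≤K

-- Each rule is
-- kept and its conversion is replaced by modus ponens with P ⇒ Q.
module EliminateRewriting {S : Signature} (R : RewriteSystem {S}) (Γ : List (Form {S} []))
  (equivalence : ∀ {Δ} (P Q : Form Δ) → _↔*_ R P Q → Σ ℕ λ k → Γ ⊢^ k ∶ (P ⇔' Q)) where

  convert : ∀ {Δ} {H : List (Form Δ)} {P Q} → axioms Γ Δ ⊆ H → _↔*_ R P Q →
            Deriv ∅ H P → Deriv ∅ H Q
  convert {P = P} {Q} Γ⊆H c d with equivalence P Q c
  ... | _ , P⇔Q , _ = ⇒E (∧E₁ {A = P ⇒' Q} {B = Q ⇒' P} (weaken P⇔Q Γ⊆H) ε) ε d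

  convert⁻¹ : ∀ {Δ} {H : List (Form Δ)} {P Q} → axioms Γ Δ ⊆ H → _↔*_ R Q P →
              Deriv ∅ H P → Deriv ∅ H Q
  convert⁻¹ Γ⊆H c = convert Γ⊆H (EqClosure.symmetric (StepF R) c)

  axioms-∷ : ∀ {Δ} {A : Form Δ} {H} → axioms Γ Δ ⊆ H → axioms Γ Δ ⊆ A ∷ H
  axioms-∷ Γ⊆H m = Any.there (Γ⊆H m)

  axioms-wk : ∀ {Δ s} {H : List (Form Δ)} → axioms Γ Δ ⊆ H → axioms Γ (s ∷ Δ) ⊆ map wkF H
  axioms-wk {H = H} Γ⊆H = subst (_⊆ map wkF H) (renF-axioms there Γ) (map⁺ wkF Γ⊆H)

  eliminate : ∀ {Δ} {H : List (Form Δ)} {C} → Deriv R H C → axioms Γ Δ ⊆ H → Deriv ∅ H C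
  eliminate (ax m c)     Γ⊆H = convert Γ⊆H c (ax m ε)
  eliminate (⇒I d c)     Γ⊆H = convert⁻¹ Γ⊆H c (⇒I (eliminate d (axioms-∷ Γ⊆H)) ε)
  eliminate (⇒E d c e)   Γ⊆H = ⇒E (convert Γ⊆H c (eliminate d Γ⊆H)) ε (eliminate e Γ⊆H)
  eliminate (∧I d e c)   Γ⊆H = convert⁻¹ Γ⊆H c (∧I (eliminate d Γ⊆H) (eliminate e Γ⊆H) ε)
  eliminate (∧E₁ d c)    Γ⊆H = ∧E₁ (convert Γ⊆H c (eliminate d Γ⊆H)) ε
  eliminate (∧E₂ d c)    Γ⊆H = ∧E₂ (convert Γ⊆H c (eliminate d Γ⊆H)) ε
  eliminate (∨I₁ d c)    Γ⊆H = convert⁻¹ Γ⊆H c (∨I₁ (eliminate d Γ⊆H) ε)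
  eliminate (∨I₂ d c)    Γ⊆H = convert⁻¹ Γ⊆H c (∨I₂ (eliminate d Γ⊆H) ε)
  eliminate (∨E d c e f) Γ⊆H = ∨E (convert Γ⊆H c (eliminate d Γ⊆H)) ε
                                  (eliminate e (axioms-∷ Γ⊆H)) (eliminate f (axioms-∷ Γ⊆H))
  eliminate (∀I d c)     Γ⊆H = convert⁻¹ Γ⊆H c (∀I (eliminate d (axioms-wk Γ⊆H)) ε)
  eliminate (∀E d c t)   Γ⊆H = ∀E (convert Γ⊆H c (eliminate d Γ⊆H)) ε t
  eliminate (∃I t d c)   Γ⊆H = convert⁻¹ Γ⊆H c (∃I t (eliminate d Γ⊆H) ε)
  eliminate (∃E d c e)   Γ⊆H = ∃E (convert Γ⊆H c (eliminate d Γ⊆H)) ε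
                                  (eliminate e (axioms-∷ (axioms-wk Γ⊆H)))
  eliminate (⊤I c)       Γ⊆H = convert⁻¹ Γ⊆H c (⊤I ε)
  eliminate (⊥E d c)     Γ⊆H = ⊥E (convert Γ⊆H c (eliminate d Γ⊆H)) ε
  eliminate (EM c)       Γ⊆H = convert⁻¹ Γ⊆H c (EM ε)

open EliminateRewriting using (eliminate)

finiteBound : ∀ {a} {A : Set a} (L : List A) (f : ∀ {x} → x ∈ L → ℕ) →
              ∃[ K ] (∀ {x} (m : x ∈ L) → f m ≤ K)
finiteBound []      f = 0 , λ ()
finiteBound (x ∷ L) f with finiteBound L (λ m → f (Any.there m))
... | K , bounded = f (Any.here refl) ⊔ K ,
  λ { (Any.here refl) → m≤m⊔n _ K ; (Any.there m) → ≤-trans (bounded m) (m≤n⊔m _ K) }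

-- Proposition 2.3: proofs from Γ₁ translate into proofs from Γ₂ of at most
-- C times the length, with C one more than the longest pure proof from Γ₂
-- of an axiom of Γ₁.
proposition2p3 : (S : Signature) (R : RewriteSystem {S}) (Γ₁ Γ₂ : List (Form {S} [])) →
    Compatible R Γ₁ → Compatible R Γ₂ →
    ∃[ C ] (∀ (Δ : List (Sort S)) (P : Form Δ) (n : ℕ) →
    Γ₁ ⊢^ n ∶ P → Γ₂ ⊢^ (C * n) ∶ P)
proposition2p3 S R Γ₁ Γ₂ (_ , provable₁) (equivalence₂ , _) = suc K , translate
  where
  -- each axiom of Γ₁ is provable modulo R, hence purely from Γ₂
  axiomProof : ∀ {B} → B ∈ Γ₁ → Deriv ∅ (axioms Γ₂ []) B
  axiomProof {B} m = eliminate R Γ₂ equivalence₂ (weaken (proj₁ (proj₂ (provable₁ B m))) (λ ())) (λ n → n)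

  axiomBound : ∃[ K ] (∀ {B} (m : B ∈ Γ₁) → size ∅ (axiomProof m) ≤ K)
  axiomBound = finiteBound Γ₁ (λ m → size ∅ (axiomProof m))

  K : ℕ
  K = proj₁ axiomBound

  axiomProofs : ∀ Δ → axioms Γ₂ Δ ⊩[ suc K ] axioms Γ₁ Δ
  axiomProofs Δ = subst (_⊩[ suc K ] axioms Γ₁ Δ) (renF-axioms noVar Γ₂) (⊩-rename noVar bounded)
    where
    bounded : axioms Γ₂ [] ⊩[ suc K ] Γ₁
    bounded m = axiomProof m , ≤-trans (proj₂ axiomBound m) (n≤1+n K)

  translate : ∀ Δ (P : Form Δ) n → Γ₁ ⊢^ n ∶ P → Γ₂ ⊢^ (suc K * n) ∶ P
  translate Δ P n (d , |d|≤n) with substHyps (s≤s z≤n) (axiomProofs Δ) d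
  ... | d' , |d'|≤ = d' , ≤-trans |d'|≤ (*-monoʳ-≤ (suc K) |d|≤n)
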